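{- Let $r \geq 4$, $\delta \geq 2$ and $c \geq 0$ be integers. Then there exists a connected triangle-free graph with $n = 2\left\lceil \frac{r\delta}{2}\right\rceil + c$ vertices, minimum degree $\delta$ and radius $r$.
   Context: Graphs are finite and simple. The radius of a connected graph $G$ is $\min_v \max_w d(v,w)$, with $d$ the graph distance. -}

module Defs where

open import Data.Nat using (ℕ; zero; suc; _≤_; _∸_)
open import Data.Fin using (Fin)
open import Data.Bool using (Bool; true; false; T)
open import Data.List using (length; filterᵇ)
open import Data.List using () renaming (allFin to allFinL)
open import Data.Product using (Σ; ∃; ∃-syntax; _×_; _,_)
open import Relation.Binary.PropositionalEquality using (_≡_)
open import Relation.Nullary using (¬_)
open import Data.Empty using (⊥)

record Graph (n : ℕ) : Set where
  field
    adj   : Fin n → Fin n → Bool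
    sym   : ∀ u v → adj u v ≡ adj v u
    irrefl : ∀ v → adj v v ≡ false

open Graph public

module _ {n : ℕ} (G : Graph n) where

  Adj : Fin n → Fin n → Set
  Adj u v = T (adj G u v)

  degree : Fin n → ℕ
  degree v = length (filterᵇ (adj G v) (allFinL n))

  MinDegree : ℕ → Set
  MinDegree δ = (∀ v → δ ≤ degree v) × ∃[ v ] degree v ≡ δ

  TriangleFree : Set
  TriangleFree = ∀ u v w → Adj u v → Adj v w → Adj u w → ⊥

  data Walk : Fin n → Fin n → ℕ → Set where
    [] : ∀ {u} → Walk u u zero
    _∷_ : ∀ {u v w k} → Adj u v → Walk v w k → Walk u w (suc k)

  DistLe : Fin n → Fin n → ℕ → Set
  DistLe u v k = ∃[ m ] (m ≤ k × Walk u v m)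

  Connected : Set
  Connected = ∀ u v → ∃[ k ] Walk u v k

  EccLe : Fin n → ℕ → Set
  EccLe v k = ∀ w → DistLe v w k

  -- radius = r : some vertex has eccentricity ≤ r, and every vertex has
  -- eccentricity > r - 1 (for r ≥ 1).  Meaningful for connected graphs.
  Radius : ℕ → Set
  Radius r = (∃[ v ] EccLe v r) × (∀ v → ¬ EccLe v (r ∸ 1))

-- Blow up the cycle C_{2r}: position q becomes an independent block of ⌈δ/2⌉ vertices
-- if q ≡ 0, 1 (mod 4) and of ⌊δ/2⌋ vertices otherwise, the c spare vertices join the
-- block at position 0, and blocks at adjacent positions are completely joined.  As 2r is
-- even the graph is bipartite, hence triangle-free.  A vertex at position p sees the
-- blocks at p ± 1, which are two apart, so one is large: its degree is at least
-- ⌈δ/2⌉ + ⌊δ/2⌋ = δ, with equality at position 2.  Four consecutive blocks hold 2δ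
-- vertices, which gives the order 2⌈rδ/2⌉ + c.  Position 0 reaches every position
-- within r steps, while the cyclic distance between positions changes by at most one
-- along an edge, so every vertex is at distance at least r from the antipodal block.
module Submission where

open import Defs hiding (sym)
open import Data.Nat using (ℕ; zero; suc; _+_; _*_; _∸_; _⊓_; ∣_-_∣; _≤_; _<_; z≤n; s≤s;
  ⌈_/2⌉; ⌊_/2⌋; _<?_; _≤?_; parity)
open import Data.Nat.Properties
open import Data.Nat.Solver using (module +-*-Solver)
open import Data.Parity.Base using (0ℙ; _⁻¹)
import Data.Parity.Properties as ℙ
open import Data.Fin using (Fin)
open import Data.Bool using (Bool; true; false; T; not; if_then_else_)
open import Data.List using (List; []; _∷_; _++_; replicate; length; filterᵇ; map; lookup)
open import Data.List using () renaming (allFin to allFinL)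
open import Data.List.Properties using (tabulate-lookup; map-tabulate; length-++; length-replicate)
open import Data.List.Membership.Propositional using (_∈_)
open import Data.List.Membership.Propositional.Properties using (∈-++⁺ˡ; ∈-++⁺ʳ; ∈-lookup)
open import Data.List.Relation.Unary.All as All using (All)
open import Data.List.Relation.Unary.All.Properties using (++⁺; replicate⁺)
open import Data.List.Relation.Unary.Any using (here; index)
open import Data.List.Relation.Unary.Any.Properties using (lookup-index)
open import Data.Product using (Σ; Σ-syntax; ∃-syntax; _×_; _,_; proj₂; swap)
open import Data.Sum using (_⊎_; inj₁; inj₂)
open import Data.Empty using (⊥)
open import Function using (_∘_; id)
open import Function.Bundles using (mk⇔)
open import Relation.Nullary using (Dec; does; yes; no)
open import Relation.Nullary.Decidable
  using (⌊_⌋; _⊎-dec_; _×-dec_; toWitness; fromWitness; isYes≗does; does-⇔; dec-false)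
open import Relation.Binary.PropositionalEquality

module _ {n : ℕ} {G : Graph n} where

  Adj-sym : ∀ {u v} → Adj G u v → Adj G v u
  Adj-sym {u} {v} = subst T (Graph.sym G u v)

  _++ʷ_ : ∀ {u v w k l} → Walk G u v k → Walk G v w l → Walk G u w (k + l)
  [] ++ʷ q = q
  (e ∷ p) ++ʷ q = e ∷ (p ++ʷ q)

  reverseʷ : ∀ {u v k} → Walk G u v k → Walk G v u k
  reverseʷ [] = []
  reverseʷ {k = suc k} (e ∷ p) = subst (Walk G _ _) (+-comm k 1) (reverseʷ p ++ʷ (Adj-sym e ∷ []))

EccLe⇒Connected : ∀ {n} (G : Graph n) {v k} → EccLe G v k → Connected G
EccLe⇒Connected G ecc u w with ecc u | ecc w
... | _ , _ , p | _ , _ , q = _ , reverseʷ p ++ʷ q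

∑ : ℕ → (ℕ → ℕ) → ℕ
∑ zero f = 0
∑ (suc n) f = ∑ n f + f n

∑-mono : ∀ f {m n} → m ≤ n → ∑ m f ≤ ∑ n f
∑-mono f {n = zero} z≤n = ≤-refl
∑-mono f {m} {suc n} m≤1+n with m≤n⇒m<n∨m≡n m≤1+n
... | inj₁ (s≤s m≤n) = ≤-trans (∑-mono f m≤n) (m≤m+n (∑ n f) (f n))
... | inj₂ refl = ≤-refl

term≤∑ : ∀ f {i n} → i < n → f i ≤ ∑ n f
term≤∑ f {i} i<n = ≤-trans (m≤n+m (f i) (∑ i f)) (∑-mono f i<n)

two-terms≤∑ : ∀ f {i j n} → i < j → j < n → f i + f j ≤ ∑ n f
two-terms≤∑ f {i} {j} i<j j<n = ≤-trans (+-monoˡ-≤ (f j) (term≤∑ f i<j)) (∑-mono f j<n)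

∑-vanishing : ∀ f {m n} → (∀ q → m ≤ q → f q ≡ 0) → m ≤ n → ∑ n f ≡ ∑ m f
∑-vanishing f {n = zero} _ z≤n = refl
∑-vanishing f {m} {suc n} f≡0 m≤1+n with m≤n⇒m<n∨m≡n m≤1+n
... | inj₂ refl = refl
... | inj₁ (s≤s m≤n) = begin
  ∑ n f + f n  ≡⟨ cong (∑ n f +_) (f≡0 n m≤n) ⟩
  ∑ n f + 0    ≡⟨ +-identityʳ (∑ n f) ⟩
  ∑ n f        ≡⟨ ∑-vanishing f f≡0 m≤n ⟩
  ∑ m f        ∎
  where open ≡-Reasoning

count : {A : Set} → (A → Bool) → List A → ℕ
count P xs = length (filterᵇ P xs)

count-map : ∀ {A B : Set} (P : B → Bool) (f : A → B) xs → count P (map f xs) ≡ count (P ∘ f) xs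
count-map P f [] = refl
count-map P f (x ∷ xs) with P (f x)
... | true = cong suc (count-map P f xs)
... | false = count-map P f xs

count-++ : ∀ {A : Set} P (xs ys : List A) → count P (xs ++ ys) ≡ count P xs + count P ys
count-++ P [] ys = refl
count-++ P (x ∷ xs) ys with P x
... | true = cong suc (count-++ P xs ys)
... | false = count-++ P xs ys

count-replicate : ∀ {A : Set} P m (x : A) → count P (replicate m x) ≡ (if P x then m else 0)
count-replicate P zero x with P x
... | true = refl
... | false = refl
count-replicate P (suc m) x with P x | count-replicate P m x
... | true | ih = cong suc ih
... | false | ih = ih

∈-replicate : ∀ {A : Set} {m} {x : A} → 0 < m → x ∈ replicate m x
∈-replicate (s≤s _) = here refl

if-T : ∀ {b} m → T b → (if b then m else 0) ≡ m
if-T {true} m _ = refl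

module BlowUp (B : ℕ → ℕ → Bool) (B-sym : ∀ p q → B p q ≡ B q p) (B-irrefl : ∀ p → B p p ≡ false)
              (size : ℕ → ℕ) (size-pos : ∀ q → 0 < size q) (M : ℕ) where

  blocks : ℕ → List ℕ
  blocks zero = []
  blocks (suc n) = blocks n ++ replicate (size n) n

  order : ℕ
  order = length (blocks M)

  length-blocks : ∀ n → length (blocks n) ≡ ∑ n size
  length-blocks zero = refl
  length-blocks (suc n) =
    trans (length-++ (blocks n)) (cong₂ _+_ (length-blocks n) (length-replicate (size n)))

  blocks-below : ∀ n → n ≤ M → All (_< M) (blocks n)
  blocks-below zero _ = All.[]
  blocks-below (suc n) n<M = ++⁺ (blocks-below n (<⇒≤ n<M)) (replicate⁺ (size n) n<M)

  ∈-blocks : ∀ {q n} → q < n → q ∈ blocks n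
  ∈-blocks {q} {suc n} q<1+n with m≤n⇒m<n∨m≡n q<1+n
  ... | inj₁ (s≤s q<n) = ∈-++⁺ˡ (∈-blocks q<n)
  ... | inj₂ refl = ∈-++⁺ʳ (blocks q) (∈-replicate (size-pos q))

  label : Fin order → ℕ
  label = lookup (blocks M)

  map-label-allFin : map label (allFinL order) ≡ blocks M
  map-label-allFin = trans (map-tabulate id label) (tabulate-lookup (blocks M))

  label< : ∀ v → label v < M
  label< v = All.lookup (blocks-below M ≤-refl) (∈-lookup v)

  vertexAt : ∀ q → q < M → Fin order
  vertexAt q q<M = index (∈-blocks q<M)

  label-vertexAt : ∀ q (q<M : q < M) → label (vertexAt q q<M) ≡ q
  label-vertexAt q q<M = sym (lookup-index (∈-blocks q<M))

  blowUp : Graph order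
  blowUp = record
    { adj = λ u w → B (label u) (label w)
    ; sym = λ u w → B-sym (label u) (label w)
    ; irrefl = λ v → B-irrefl (label v)
    }

  neighbourSize : ℕ → ℕ → ℕ
  neighbourSize p q = if B p q then size q else 0

  count-blocks : ∀ P n → count P (blocks n) ≡ ∑ n (λ q → if P q then size q else 0)
  count-blocks P zero = refl
  count-blocks P (suc n) =
    trans (count-++ P (blocks n) _) (cong₂ _+_ (count-blocks P n) (count-replicate P (size n) n))

  degree-blowUp : ∀ v → degree blowUp v ≡ ∑ M (neighbourSize (label v))
  degree-blowUp v = begin
    count (B (label v) ∘ label) (allFinL order)    ≡⟨ count-map (B (label v)) label (allFinL order) ⟨
    count (B (label v)) (map label (allFinL order)) ≡⟨ cong (count _) map-label-allFin ⟩
    count (B (label v)) (blocks M)                 ≡⟨ count-blocks (B (label v)) M ⟩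
    ∑ M (neighbourSize (label v))                  ∎
    where open ≡-Reasoning

  two-neighbours≤degree : ∀ v {i j} → i < j → j < M → T (B (label v) i) → T (B (label v) j) →
                          size i + size j ≤ degree blowUp v
  two-neighbours≤degree v {i} {j} i<j j<M Bi Bj = begin
    size i + size j                                          ≡⟨ cong₂ _+_ (if-T (size i) Bi) (if-T (size j) Bj) ⟨
    neighbourSize (label v) i + neighbourSize (label v) j    ≤⟨ two-terms≤∑ (neighbourSize (label v)) i<j j<M ⟩
    ∑ M (neighbourSize (label v))                            ≡⟨ degree-blowUp v ⟨
    degree blowUp v                                          ∎
    where open ≤-Reasoning

  walk-lipschitz : (φ : ℕ → ℕ) → (∀ p q → T (B p q) → φ q ≤ suc (φ p)) →
                   ∀ {u w m} → Walk blowUp u w m → φ (label w) ≤ φ (label u) + m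
  walk-lipschitz φ φ-lip [] = m≤m+n _ 0
  walk-lipschitz φ φ-lip {u} {w} {suc m} (_∷_ {v = v} e p) = begin
    φ (label w)            ≤⟨ walk-lipschitz φ φ-lip p ⟩
    φ (label v) + m        ≤⟨ +-monoˡ-≤ m (φ-lip (label u) (label v) e) ⟩
    suc (φ (label u)) + m  ≡⟨ +-suc (φ (label u)) m ⟨
    φ (label u) + suc m    ∎
    where open ≤-Reasoning

Near : ℕ → ℕ → Set
Near x y = x ≤ suc y × y ≤ suc x

Near-suc : ∀ n → Near n (suc n)
Near-suc n = m≤n⇒m≤1+n (n≤1+n n) , ≤-refl

Near-∣-suc∣ : ∀ m n → Near ∣ m - n ∣ ∣ m - suc n ∣
Near-∣-suc∣ zero n = Near-suc n
Near-∣-suc∣ (suc m) zero = subst (Near (suc m)) (sym (∣-∣-identityʳ m)) (swap (Near-suc m))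
Near-∣-suc∣ (suc m) (suc n) = Near-∣-suc∣ m n

m∸n≤1+[m∸1+n] : ∀ m n → m ∸ n ≤ suc (m ∸ suc n)
m∸n≤1+[m∸1+n] zero zero = z≤n
m∸n≤1+[m∸1+n] (suc m) zero = ≤-refl
m∸n≤1+[m∸1+n] zero (suc n) = z≤n
m∸n≤1+[m∸1+n] (suc m) (suc n) = m∸n≤1+[m∸1+n] m n

∸-≤-suc : ∀ k {x y} → x ≤ suc y → k ∸ y ≤ suc (k ∸ x)
∸-≤-suc k {x} {y} x≤1+y = ≤-trans (m∸n≤1+[m∸1+n] k y) (s≤s (∸-monoʳ-≤ k x≤1+y))

Near-⊓∸ : ∀ M {x y} → Near x y → Near (x ⊓ (M ∸ x)) (y ⊓ (M ∸ y))
Near-⊓∸ M (x≤1+y , y≤1+x) =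
  ⊓-mono-≤ x≤1+y (∸-≤-suc M y≤1+x) , ⊓-mono-≤ y≤1+x (∸-≤-suc M x≤1+y)

⊓∸-reflect : ∀ {M x} → x ≤ M → (M ∸ x) ⊓ (M ∸ (M ∸ x)) ≡ x ⊓ (M ∸ x)
⊓∸-reflect {M} {x} x≤M = trans (cong ((M ∸ x) ⊓_) (m∸[m∸n]≡n x≤M)) (⊓-comm (M ∸ x) x)

parity-suc : ∀ n → parity (suc n) ≡ parity n ⁻¹
parity-suc n = sym (ℙ.⁻¹-selfInverse (ℙ.suc-homo-⁻¹ n))

-- M is a parameter rather than r + r so that callers can pass a form of M that computes.
module Cycle (r M : ℕ) (M≡r+r : M ≡ r + r) where

  CycleEdge : ℕ → ℕ → Set
  CycleEdge p q = suc p ≡ q ⊎ suc q ≡ p ⊎ (p ≡ 0 × suc q ≡ M) ⊎ (q ≡ 0 × suc p ≡ M)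

  pattern up = inj₁ refl
  pattern down = inj₂ (inj₁ refl)
  pattern wrapDown e = inj₂ (inj₂ (inj₁ (refl , e)))
  pattern wrapUp e = inj₂ (inj₂ (inj₂ (refl , e)))

  CycleEdge-sym : ∀ {p q} → CycleEdge p q → CycleEdge q p
  CycleEdge-sym up = down
  CycleEdge-sym down = up
  CycleEdge-sym (wrapDown e) = wrapUp e
  CycleEdge-sym (wrapUp e) = wrapDown e

  cycleEdge? : ∀ p q → Dec (CycleEdge p q)
  cycleEdge? p q =
    (suc p ≟ q) ⊎-dec (suc q ≟ p) ⊎-dec
    ((p ≟ 0) ×-dec (suc q ≟ M)) ⊎-dec ((q ≟ 0) ×-dec (suc p ≟ M))

  cycle : ℕ → ℕ → Bool
  cycle p q = ⌊ cycleEdge? p q ⌋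

  cycle-sym : ∀ p q → cycle p q ≡ cycle q p
  cycle-sym p q = begin
    ⌊ cycleEdge? p q ⌋       ≡⟨ isYes≗does (cycleEdge? p q) ⟩
    does (cycleEdge? p q)    ≡⟨ does-⇔ (mk⇔ CycleEdge-sym CycleEdge-sym) (cycleEdge? p q) (cycleEdge? q p) ⟩
    does (cycleEdge? q p)    ≡⟨ isYes≗does (cycleEdge? q p) ⟨
    ⌊ cycleEdge? q p ⌋       ∎
    where open ≡-Reasoning

  parity-flips : ∀ {p q} → CycleEdge p q → parity q ≡ parity p ⁻¹
  parity-flips {p} up = parity-suc p
  parity-flips {q = q} (wrapDown e) = begin
    parity q                 ≡⟨ ℙ.suc-homo-⁻¹ q ⟨
    parity (suc q) ⁻¹        ≡⟨ cong (λ n → parity n ⁻¹) (trans e M≡r+r) ⟩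
    parity (r + r) ⁻¹        ≡⟨ cong _⁻¹ (trans (ℙ.+-homo-+ r r) (ℙ.p+p≡0ℙ (parity r))) ⟩
    0ℙ ⁻¹                    ∎
    where open ≡-Reasoning
  parity-flips {q = q} down = sym (ℙ.⁻¹-selfInverse (sym (parity-flips {q} up)))
  parity-flips (wrapUp e) = sym (ℙ.⁻¹-selfInverse (sym (parity-flips (wrapDown e))))

  cycle-irrefl : ∀ p → cycle p p ≡ false
  cycle-irrefl p = trans (isYes≗does (cycleEdge? p p))
                         (dec-false (cycleEdge? p p) (λ e → ℙ.p≢p⁻¹ (parity p) (parity-flips e)))

  cycle-triangle-free : ∀ p q o → T (cycle p q) → T (cycle q o) → T (cycle p o) → ⊥
  cycle-triangle-free p q o pq qo po = ℙ.p≢p⁻¹ (parity p) (begin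
    parity p              ≡⟨ ℙ.⁻¹-involutive (parity p) ⟨
    parity p ⁻¹ ⁻¹        ≡⟨ cong _⁻¹ (parity-flips (toWitness pq)) ⟨
    parity q ⁻¹           ≡⟨ parity-flips (toWitness qo) ⟨
    parity o              ≡⟨ parity-flips (toWitness po) ⟩
    parity p ⁻¹           ∎)
    where open ≡-Reasoning

  cycDist : ℕ → ℕ → ℕ
  cycDist p q = ∣ p - q ∣ ⊓ (M ∸ ∣ p - q ∣)

  cycDist-self : ∀ p → cycDist p p ≡ 0
  cycDist-self p = cong (λ x → x ⊓ (M ∸ x)) (∣n-n∣≡0 p)

  cycDist-0 : ∀ p → cycDist p 0 ≡ p ⊓ (M ∸ p)
  cycDist-0 p = cong (λ x → x ⊓ (M ∸ x)) (∣-∣-identityʳ p)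

  cycDist-last : ∀ {p q} → p < M → suc q ≡ M → cycDist p q ≡ suc p ⊓ (M ∸ suc p)
  cycDist-last {p} {q} p<M e = begin
    ∣ p - q ∣ ⊓ (M ∸ ∣ p - q ∣)              ≡⟨ cong (λ x → x ⊓ (M ∸ x)) (m≤n⇒∣m-n∣≡n∸m p≤q) ⟩
    (q ∸ p) ⊓ (M ∸ (q ∸ p))                  ≡⟨ ⊓∸-reflect q∸p≤M ⟨
    (M ∸ (q ∸ p)) ⊓ (M ∸ (M ∸ (q ∸ p)))      ≡⟨ cong (λ x → x ⊓ (M ∸ x)) M∸[q∸p]≡1+p ⟩
    suc p ⊓ (M ∸ suc p)                      ∎
    where
    open ≡-Reasoning
    p≤q : p ≤ q
    p≤q = ≤-pred (subst (p <_) (sym e) p<M)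
    q∸p≤M : q ∸ p ≤ M
    q∸p≤M = ≤-trans (m∸n≤m q p) (subst (q ≤_) e (n≤1+n q))
    M∸[q∸p]≡1+p : M ∸ (q ∸ p) ≡ suc p
    M∸[q∸p]≡1+p = begin
      M ∸ (q ∸ p)          ≡⟨ cong (_∸ (q ∸ p)) e ⟨
      suc q ∸ (q ∸ p)      ≡⟨ +-∸-assoc 1 (m∸n≤m q p) ⟩
      suc (q ∸ (q ∸ p))    ≡⟨ cong suc (m∸[m∸n]≡n p≤q) ⟩
      suc p                ∎

  Near-cycDist : ∀ {p} → p < M → ∀ {q q′} → CycleEdge q q′ → Near (cycDist p q) (cycDist p q′)
  Near-cycDist {p} p<M up = Near-⊓∸ M (Near-∣-suc∣ p _)
  Near-cycDist {p} p<M down = swap (Near-⊓∸ M (Near-∣-suc∣ p _))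
  Near-cycDist {p} p<M (wrapDown e) =
    subst₂ Near (sym (cycDist-0 p)) (sym (cycDist-last p<M e)) (Near-⊓∸ M (Near-suc p))
  Near-cycDist p<M (wrapUp e) = swap (Near-cycDist p<M (wrapDown e))

  cycDist-≡r : ∀ {p q} → ∣ p - q ∣ ≡ r → cycDist p q ≡ r
  cycDist-≡r {p} {q} e = begin
    ∣ p - q ∣ ⊓ (M ∸ ∣ p - q ∣)  ≡⟨ cong (λ x → x ⊓ (M ∸ x)) e ⟩
    r ⊓ (M ∸ r)                  ≡⟨ cong (λ x → r ⊓ (x ∸ r)) M≡r+r ⟩
    r ⊓ (r + r ∸ r)              ≡⟨ cong (r ⊓_) (m+n∸n≡m r r) ⟩
    r ⊓ r                        ≡⟨ ⊓-idem r ⟩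
    r                            ∎
    where open ≡-Reasoning

  antipode : ∀ p → p < M → ∃[ q ] q < M × cycDist p q ≡ r
  antipode p p<M with p <? r
  ... | yes p<r = p + r , subst (p + r <_) (sym M≡r+r) (+-monoˡ-< r p<r) ,
                  cycDist-≡r {p} {p + r} (trans (m≤n⇒∣m-n∣≡n∸m (m≤m+n p r)) (m+n∸m≡n p r))
  ... | no p≮r = p ∸ r , ≤-<-trans (m∸n≤m p r) p<M ,
                 cycDist-≡r {p} {p ∸ r}
                   (trans (m≤n⇒∣n-m∣≡n∸m (m∸n≤m p r)) (m∸[m∸n]≡n (≮⇒≥ p≮r)))

⌈n/2⌉+⌊n/2⌋≡n : ∀ n → ⌈ n /2⌉ + ⌊ n /2⌋ ≡ n
⌈n/2⌉+⌊n/2⌋≡n n = trans (+-comm ⌈ n /2⌉ ⌊ n /2⌋) (⌊n/2⌋+⌈n/2⌉≡n n)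

⌈m+[m+n]/2⌉≡m+⌈n/2⌉ : ∀ m n → ⌈ m + (m + n) /2⌉ ≡ m + ⌈ n /2⌉
⌈m+[m+n]/2⌉≡m+⌈n/2⌉ zero n = refl
⌈m+[m+n]/2⌉≡m+⌈n/2⌉ (suc m) n =
  trans (cong (λ x → ⌈ suc x /2⌉) (+-suc m (m + n))) (cong suc (⌈m+[m+n]/2⌉≡m+⌈n/2⌉ m n))

[2+n]+[2+n]≡4+[n+n] : ∀ n → (2 + n) + (2 + n) ≡ 4 + (n + n)
[2+n]+[2+n]≡4+[n+n] n = cong (suc ∘ suc) (trans (+-suc n (suc n)) (cong suc (+-suc n n)))

heavy : ℕ → Bool
heavy 0 = true
heavy 1 = true
heavy (suc (suc q)) = not (heavy q)

blockSize : ℕ → ℕ → ℕ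
blockSize δ q = if heavy q then ⌈ δ /2⌉ else ⌊ δ /2⌋

blockSize-heavy : ∀ δ {q} → T (heavy q) → blockSize δ q ≡ ⌈ δ /2⌉
blockSize-heavy δ {q} _ with heavy q
... | true = refl

⌊n/2⌋≤blockSize : ∀ δ q → ⌊ δ /2⌋ ≤ blockSize δ q
⌊n/2⌋≤blockSize δ q with heavy q
... | true = ⌊n/2⌋≤⌈n/2⌉ δ
... | false = ≤-refl

blockSize-pair : ∀ δ q → blockSize δ q + blockSize δ (2 + q) ≡ δ
blockSize-pair δ q with heavy q
... | true = ⌈n/2⌉+⌊n/2⌋≡n δ
... | false = ⌊n/2⌋+⌈n/2⌉≡n δ

∑-blockSize : ∀ δ r → ∑ (r + r) (blockSize δ) ≡ 2 * ⌈ r * δ /2⌉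
∑-blockSize δ zero = refl
∑-blockSize δ (suc zero) = begin
  ⌈ δ /2⌉ + ⌈ δ /2⌉         ≡⟨ cong (⌈ δ /2⌉ +_) (+-identityʳ ⌈ δ /2⌉) ⟨
  2 * ⌈ δ /2⌉               ≡⟨ cong (λ n → 2 * ⌈ n /2⌉) (*-identityˡ δ) ⟨
  2 * ⌈ 1 * δ /2⌉           ∎
  where open ≡-Reasoning
∑-blockSize δ (suc (suc r)) = begin
  ∑ ((2 + r) + (2 + r)) b                          ≡⟨ cong (λ n → ∑ n b) ([2+n]+[2+n]≡4+[n+n] r) ⟩
  ∑ k b + b k + b (1 + k) + b (2 + k) + b (3 + k)  ≡⟨ regroup ⟩
  ∑ k b + (b k + b (2 + k)) + (b (1 + k) + b (3 + k))
    ≡⟨ cong₂ (λ x y → ∑ k b + x + y) (blockSize-pair δ k) (blockSize-pair δ (1 + k)) ⟩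
  ∑ k b + δ + δ                                    ≡⟨ cong (λ x → x + δ + δ) (∑-blockSize δ r) ⟩
  2 * ⌈ r * δ /2⌉ + δ + δ
    ≡⟨ solve 2 (λ x d → con 2 :* x :+ d :+ d := con 2 :* (d :+ x)) refl ⌈ r * δ /2⌉ δ ⟩
  2 * (δ + ⌈ r * δ /2⌉)                            ≡⟨ cong (2 *_) (⌈m+[m+n]/2⌉≡m+⌈n/2⌉ δ (r * δ)) ⟨
  2 * ⌈ (2 + r) * δ /2⌉                            ∎
  where
  open ≡-Reasoning
  open +-*-Solver
  b = blockSize δ
  k = r + r
  regroup : ∑ k b + b k + b (1 + k) + b (2 + k) + b (3 + k) ≡
            ∑ k b + (b k + b (2 + k)) + (b (1 + k) + b (3 + k))
  regroup = solve 5 (λ x y₀ y₁ y₂ y₃ → x :+ y₀ :+ y₁ :+ y₂ :+ y₃ := x :+ (y₀ :+ y₂) :+ (y₁ :+ y₃))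
                    refl
                    (∑ k b) (b k) (b (1 + k)) (b (2 + k)) (b (3 + k))

ConnectedTriangleFreeGraph : (n δ r : ℕ) → Set
ConnectedTriangleFreeGraph n δ r =
  Σ (Graph n) λ G → Connected G × TriangleFree G × MinDegree G δ × Radius G r

module BlownUpCycle (s δ c : ℕ) (2≤δ : 2 ≤ δ) where

  r M : ℕ
  r = 2 + s
  M = 4 + (s + s)

  size : ℕ → ℕ
  size zero = c + blockSize δ 0
  size (suc q) = blockSize δ (suc q)

  blockSize≤size : ∀ q → blockSize δ q ≤ size q
  blockSize≤size zero = m≤n+m (blockSize δ 0) c
  blockSize≤size (suc q) = ≤-refl

  ⌊δ/2⌋≤size : ∀ q → ⌊ δ /2⌋ ≤ size q
  ⌊δ/2⌋≤size q = ≤-trans (⌊n/2⌋≤blockSize δ q) (blockSize≤size q)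

  size-pos : ∀ q → 0 < size q
  size-pos q = ≤-trans (⌊n/2⌋-mono 2≤δ) (⌊δ/2⌋≤size q)

  δ≤size+size : ∀ i j → T (heavy i) → δ ≤ size i + size j
  δ≤size+size i j hi = begin
    δ                      ≡⟨ ⌈n/2⌉+⌊n/2⌋≡n δ ⟨
    ⌈ δ /2⌉ + ⌊ δ /2⌋      ≡⟨ cong (_+ ⌊ δ /2⌋) (blockSize-heavy δ {i} hi) ⟨
    blockSize δ i + ⌊ δ /2⌋ ≤⟨ +-mono-≤ (blockSize≤size i) (⌊δ/2⌋≤size j) ⟩
    size i + size j        ∎
    where open ≤-Reasoning

  δ≤size+size[2+] : ∀ q → δ ≤ size q + size (2 + q)
  δ≤size+size[2+] q = begin
    δ                                    ≡⟨ blockSize-pair δ q ⟨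
    blockSize δ q + blockSize δ (2 + q)  ≤⟨ +-mono-≤ (blockSize≤size q) (blockSize≤size (2 + q)) ⟩
    size q + size (2 + q)                ∎
    where open ≤-Reasoning

  ∑-size : ∀ n → ∑ (suc n) size ≡ c + ∑ (suc n) (blockSize δ)
  ∑-size zero = refl
  ∑-size (suc n) = trans (cong (_+ size (suc n)) (∑-size n)) (+-assoc c _ _)

  open Cycle r M (sym ([2+n]+[2+n]≡4+[n+n] s))
  open BlowUp cycle cycle-sym cycle-irrefl size size-pos M

  edge : ∀ {u w p q} → label u ≡ p → label w ≡ q → CycleEdge p q → Adj blowUp u w
  edge refl refl = fromWitness

  walkUp : ∀ d u w → suc d + label u ≡ label w → Walk blowUp u w (suc d)
  walkUp zero u w e = edge refl (sym e) up ∷ []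
  walkUp (suc d) u w e = edge refl (label-vertexAt _ 1+u<M) up ∷ walkUp d x w e′
    where
    1+u<M : suc (label u) < M
    1+u<M = <-trans (subst (suc (label u) <_) e (s≤s (s≤s (m≤n+m (label u) d)))) (label< w)
    x = vertexAt (suc (label u)) 1+u<M
    e′ : suc d + label x ≡ label w
    e′ = trans (cong (suc d +_) (label-vertexAt _ 1+u<M)) (trans (+-suc (suc d) (label u)) e)

  walkDown : ∀ d u w → suc d + label w ≡ label u → Walk blowUp u w (suc d)
  walkDown d u w e = reverseʷ (walkUp d w u e)

  v₀ : Fin order
  v₀ = vertexAt 0 (s≤s z≤n)

  label-v₀ : label v₀ ≡ 0
  label-v₀ = label-vertexAt 0 (s≤s z≤n)

  short-way-round : ∀ {a b} → a + b ≡ r + r → r ≤ a → b ≤ r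
  short-way-round {a} {b} e r≤a = +-cancelˡ-≤ r b r (≤-trans (+-monoˡ-≤ b r≤a) (≤-reflexive e))

  ecc-v₀ : EccLe blowUp v₀ r
  ecc-v₀ w = reach (label w) refl (label< w)
    where
    reach : ∀ q → label w ≡ q → q < M → DistLe blowUp v₀ w r
    reach zero lw _ = 2 , s≤s (s≤s z≤n) , edge label-v₀ label-x₁ up ∷ edge label-x₁ lw down ∷ []
      where
      label-x₁ = label-vertexAt 1 (s≤s (s≤s z≤n))
    reach (suc q) lw q<M = up-or-around (suc q ≤? r) (m≤n⇒∃[o]m+o≡n q<M)
      where
      up-or-around : Dec (suc q ≤ r) → ∃[ k ] suc (suc q) + k ≡ M → DistLe blowUp v₀ w r
      up-or-around (yes 1+q≤r) _ =
        suc q , 1+q≤r , walkUp q v₀ w (trans (cong (suc q +_) label-v₀) (trans (+-identityʳ (suc q)) (sym lw)))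
      up-or-around (no _) (zero , e) =
        1 , s≤s z≤n , edge label-v₀ lw (wrapDown (trans (sym (+-identityʳ _)) e)) ∷ []
      up-or-around (no 1+q≰r) (suc d , e) =
        suc (suc d) , short , edge label-v₀ label-y (wrapDown refl) ∷ walkDown d y w e′
        where
        y = vertexAt (3 + (s + s)) ≤-refl
        label-y = label-vertexAt (3 + (s + s)) ≤-refl
        short : suc (suc d) ≤ r
        short = short-way-round (trans (+-suc (suc q) (suc d)) (trans e (sym ([2+n]+[2+n]≡4+[n+n] s))))
                                (<⇒≤ (≰⇒> 1+q≰r))
        e′ : suc d + label w ≡ label y
        e′ = trans (cong (suc d +_) lw)
                   (trans (+-comm (suc d) (suc q)) (trans (suc-injective e) (sym label-y)))

  far : ∀ v → Σ[ w ∈ Fin order ] (∀ {m} → Walk blowUp v w m → r ≤ m)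
  far v = at-antipode (antipode p (label< v))
    where
    p = label v
    lipschitz : ∀ q q′ → T (cycle q q′) → cycDist p q′ ≤ suc (cycDist p q)
    lipschitz q q′ e = proj₂ (Near-cycDist (label< v) (toWitness e))
    at-antipode : ∃[ q ] q < M × cycDist p q ≡ r →
                  Σ[ w ∈ Fin order ] (∀ {m} → Walk blowUp v w m → r ≤ m)
    at-antipode (q , q<M , dist≡r) = vertexAt q q<M , r≤length
      where
      r≤length : ∀ {m} → Walk blowUp v (vertexAt q q<M) m → r ≤ m
      r≤length {m} walk = begin
        r                                     ≡⟨ dist≡r ⟨
        cycDist p q                           ≡⟨ cong (cycDist p) (label-vertexAt q q<M) ⟨
        cycDist p (label (vertexAt q q<M))    ≤⟨ walk-lipschitz (cycDist p) lipschitz walk ⟩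
        cycDist p p + m                       ≡⟨ cong (_+ m) (cycDist-self p) ⟩
        m                                     ∎
        where open ≤-Reasoning

  r≤ecc : ∀ v {k} → EccLe blowUp v k → r ≤ k
  r≤ecc v ecc =
    let w , r≤length = far v
        m , m≤k , walk = ecc w
    in ≤-trans (r≤length walk) m≤k

  radius : Radius blowUp r
  radius = (v₀ , ecc-v₀) , λ v ecc → n≮n (suc s) (r≤ecc v ecc)

  δ≤degree : ∀ v → δ ≤ degree blowUp v
  δ≤degree v = go (label v) refl (label< v)
    where
    via : ∀ {p i j} → label v ≡ p → i < j → j < M → CycleEdge p i → CycleEdge p j →
          δ ≤ size i + size j → δ ≤ degree blowUp v
    via refl i<j j<M pi pj δ≤ =
      ≤-trans δ≤ (two-neighbours≤degree v i<j j<M (fromWitness pi) (fromWitness pj))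
    go : ∀ p → label v ≡ p → p < M → δ ≤ degree blowUp v
    go zero lv _ = via lv (s≤s (s≤s z≤n)) ≤-refl up (wrapDown refl) (δ≤size+size 1 (3 + (s + s)) _)
    go (suc p) lv 1+p<M = interior-or-last (m≤n⇒m<n∨m≡n 1+p<M)
      where
      interior-or-last : 2 + p < M ⊎ 2 + p ≡ M → δ ≤ degree blowUp v
      interior-or-last (inj₁ 2+p<M) = via lv (s≤s (n≤1+n p)) 2+p<M down up (δ≤size+size[2+] p)
      interior-or-last (inj₂ 2+p≡M) =
        via lv 0<p (<-trans (n<1+n p) 1+p<M) (wrapUp 2+p≡M) down (δ≤size+size 0 p _)
        where
        0<p : 0 < p
        0<p = subst (0 <_) (sym (suc-injective (suc-injective 2+p≡M))) (s≤s z≤n)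

  2<M : 2 < M
  2<M = s≤s (s≤s (s≤s z≤n))

  v₂ : Fin order
  v₂ = vertexAt 2 2<M

  neighbourSize-2-from-4 : ∀ q → 4 ≤ q → neighbourSize 2 q ≡ 0
  neighbourSize-2-from-4 _ (s≤s (s≤s (s≤s (s≤s _)))) = refl

  degree-v₂ : degree blowUp v₂ ≡ δ
  degree-v₂ = begin
    degree blowUp v₂                ≡⟨ degree-blowUp v₂ ⟩
    ∑ M (neighbourSize (label v₂))  ≡⟨ cong (λ p → ∑ M (neighbourSize p)) (label-vertexAt 2 2<M) ⟩
    ∑ M (neighbourSize 2)           ≡⟨ ∑-vanishing (neighbourSize 2) {4} {M} neighbourSize-2-from-4 4≤M ⟩
    ⌈ δ /2⌉ + 0 + ⌊ δ /2⌋           ≡⟨ cong (_+ ⌊ δ /2⌋) (+-identityʳ ⌈ δ /2⌉) ⟩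
    ⌈ δ /2⌉ + ⌊ δ /2⌋               ≡⟨ ⌈n/2⌉+⌊n/2⌋≡n δ ⟩
    δ                               ∎
    where
    open ≡-Reasoning
    4≤M : 4 ≤ M
    4≤M = s≤s (s≤s (s≤s (s≤s z≤n)))

  order≡ : order ≡ 2 * ⌈ r * δ /2⌉ + c
  order≡ = begin
    order                          ≡⟨ length-blocks M ⟩
    ∑ M size                       ≡⟨ ∑-size (3 + (s + s)) ⟩
    c + ∑ M (blockSize δ)          ≡⟨ cong (λ n → c + ∑ n (blockSize δ)) ([2+n]+[2+n]≡4+[n+n] s) ⟨
    c + ∑ (r + r) (blockSize δ)    ≡⟨ cong (c +_) (∑-blockSize δ r) ⟩
    c + 2 * ⌈ r * δ /2⌉            ≡⟨ +-comm c _ ⟩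
    2 * ⌈ r * δ /2⌉ + c            ∎
    where open ≡-Reasoning

  graph : ConnectedTriangleFreeGraph (2 * ⌈ r * δ /2⌉ + c) δ r
  graph = subst (λ n → ConnectedTriangleFreeGraph n δ r) order≡
    ( blowUp
    , EccLe⇒Connected blowUp ecc-v₀
    , (λ u v w → cycle-triangle-free (label u) (label v) (label w))
    , (δ≤degree , v₂ , degree-v₂)
    , radius )

blown-up-cycle : (r δ c : ℕ) → 2 ≤ r → 2 ≤ δ → ConnectedTriangleFreeGraph (2 * ⌈ r * δ /2⌉ + c) δ r
blown-up-cycle (suc (suc s)) δ c _ 2≤δ = BlownUpCycle.graph s δ c 2≤δ
blown-up-cycle (suc zero) δ c (s≤s ()) _

proposition3p2 : (r δ c : ℕ) → 4 ≤ r → 2 ≤ δ →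
    Σ (Graph (2 * ⌈ r * δ /2⌉ + c)) λ G →
      Connected G × TriangleFree G × MinDegree G δ × Radius G r
proposition3p2 r δ c 4≤r = blown-up-cycle r δ c (≤-trans (s≤s (s≤s z≤n)) 4≤r)
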